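{- Let $n\ge 4$ and let $S\subseteq V(FQ_n)$ be a determining set for the folded hypercube $FQ_n$. Then (1) $S$ is a determining set for the hypercube $Q_n$; (2) there is a determining set for $FQ_n$ of size $|S|$ containing the zero vector $\mathbf{0}$; (3) for each $i\in[n]$ there is some $\mathbf{v}\in S$ whose $i$-th position $v_i$ equals $1$.
   Context: $Q_n$ has vertex set $\mathbb{Z}_2^n$ with adjacency iff two strings differ in exactly one position. $FQ_n$ has the same vertex set, with adjacency iff two strings differ in exactly one position or in all $n$ positions. A determining set of a graph is a vertex set such that the only automorphism fixing each of its vertices is the identity. -}

module Defs where

open import Data.Nat using (ℕ; zero; suc; _+_)
open import Data.Bool using (Bool; true; false; _≟_)
open import Data.Vec using (Vec; []; _∷_; replicate; lookup)
open import Data.Fin using (Fin)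
open import Data.List using (List; length)
open import Data.List.Membership.Propositional using (_∈_)
open import Data.List.Relation.Unary.Unique.Propositional using (Unique)
open import Data.Product using (_×_; Σ; ∃; _,_)
open import Data.Sum using (_⊎_)
open import Relation.Nullary using (yes; no)
open import Relation.Binary.PropositionalEquality using (_≡_)

Vertex : ℕ → Set
Vertex n = Vec Bool n

hamming : ∀ {n} → Vertex n → Vertex n → ℕ
hamming [] [] = 0
hamming (x ∷ xs) (y ∷ ys) with x ≟ y
... | yes _ = hamming xs ys
... | no _  = suc (hamming xs ys)

Graph : Set → Set₁
Graph V = V → V → Set

Q : (n : ℕ) → Graph (Vertex n)
Q n u v = hamming u v ≡ 1

FQ : (n : ℕ) → Graph (Vertex n)
FQ n u v = (hamming u v ≡ 1) ⊎ (hamming u v ≡ n)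

record Automorphism {V : Set} (G : Graph V) : Set where
  field
    to      : V → V
    from    : V → V
    to-from : ∀ v → to (from v) ≡ v
    from-to : ∀ v → from (to v) ≡ v
    adj-⇔   : ∀ u v → (G u v → G (to u) (to v)) × (G (to u) (to v) → G u v)

IsDetermining : {V : Set} (G : Graph V) → List V → Set
IsDetermining {V} G S =
  (φ : Automorphism G) → (∀ s → s ∈ S → Automorphism.to φ s ≡ s) →
  ∀ v → Automorphism.to φ v ≡ v

𝟎 : ∀ {n} → Vertex n
𝟎 = replicate _ false

{-# OPTIONS --safe #-}
module Submission where

-- Every Q_n-automorphism preserves graph distance, which is Hamming distance,
-- hence preserves antipodal pairs and is an FQ_n-automorphism: so an FQ_n-determining
-- set is Q_n-determining.  For a coordinate i, complementing every coordinate
-- except i on the half-cube {v_i = 1} and fixing the half-cube {v_i = 0} is an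
-- FQ_n-automorphism: within a half it is a translation, and across the halves the
-- distances before and after sum to n + 1, which exchanges 1 and n.  It moves the
-- all-ones vector when n ≥ 2, so a determining set meets every half-cube {v_i = 1}.
-- Finally, translating a determining set by one of its own elements gives a
-- determining set of the same size containing 0.

open import Defs
open import Data.Nat using (ℕ; zero; suc; _+_; _≤_; z≤n; s≤s)
open import Data.Nat.Properties
  using (+-commutativeSemigroup; +-mono-≤; ≤-reflexive; ≤-antisym; +-suc; +-comm;
         +-cancelʳ-≡; suc-injective; module ≤-Reasoning)
open import Algebra.Properties.CommutativeSemigroup +-commutativeSemigroup using (interchange)
open import Data.Bool using (Bool; true; false; not; _xor_; if_then_else_; _≟_)
open import Data.Bool.Properties using (xor-assoc; xor-same; xor-comm; ¬-not)
open import Data.Vec using (_∷_; []; lookup; replicate; zipWith)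
open import Data.Vec.Properties using (lookup-replicate)
open import Data.Fin using (Fin; zero; suc)
open import Data.List using (List; length; map)
open import Data.List.Properties using (length-map)
open import Data.List.Membership.Propositional using (_∈_; find; lose)
open import Data.List.Membership.Propositional.Properties using (∈-map⁺)
open import Data.List.Relation.Unary.Any using (any?)
open import Data.List.Relation.Unary.Unique.Propositional using (Unique)
open import Data.List.Relation.Unary.Unique.Propositional.Properties using (map⁺)
open import Data.Product using (_×_; Σ; _,_; proj₁; proj₂)
open import Data.Sum using (_⊎_; inj₁; inj₂)
open import Data.Empty using (⊥-elim)
open import Function using (_∘_)
open import Relation.Nullary using (yes; no)
open import Relation.Binary.PropositionalEquality

bitDistance : Bool → Bool → ℕ
bitDistance x y = if x xor y then 1 else 0

bitDistance-sym : ∀ x y → bitDistance x y ≡ bitDistance y x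
bitDistance-sym x y = cong (if_then 1 else 0) (xor-comm x y)

bitDistance-self : ∀ x → bitDistance x x ≡ 0
bitDistance-self x = cong (if_then 1 else 0) (xor-same x)

bitDistance-triangle : ∀ x y z → bitDistance x y ≤ bitDistance x z + bitDistance z y
bitDistance-triangle true  true  _     = z≤n
bitDistance-triangle false false _     = z≤n
bitDistance-triangle true  false true  = s≤s z≤n
bitDistance-triangle true  false false = s≤s z≤n
bitDistance-triangle false true  true  = s≤s z≤n
bitDistance-triangle false true  false = s≤s z≤n

bitDistance-xorˡ : ∀ a x y → bitDistance (a xor x) (a xor y) ≡ bitDistance x y
bitDistance-xorˡ false x     y     = refl
bitDistance-xorˡ true  true  true  = refl
bitDistance-xorˡ true  true  false = refl
bitDistance-xorˡ true  false true  = refl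
bitDistance-xorˡ true  false false = refl

hamming-∷ : ∀ {n} x y (u v : Vertex n) →
  hamming (x ∷ u) (y ∷ v) ≡ bitDistance x y + hamming u v
hamming-∷ true  true  u v = refl
hamming-∷ true  false u v = refl
hamming-∷ false true  u v = refl
hamming-∷ false false u v = refl

hamming-sym : ∀ {n} (u v : Vertex n) → hamming u v ≡ hamming v u
hamming-sym []      []      = refl
hamming-sym (x ∷ u) (y ∷ v) = begin
  hamming (x ∷ u) (y ∷ v)       ≡⟨ hamming-∷ x y u v ⟩
  bitDistance x y + hamming u v ≡⟨ cong₂ _+_ (bitDistance-sym x y) (hamming-sym u v) ⟩
  bitDistance y x + hamming v u ≡⟨ hamming-∷ y x v u ⟨
  hamming (y ∷ v) (x ∷ u)       ∎
  where open ≡-Reasoning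

hamming-self : ∀ {n} (u : Vertex n) → hamming u u ≡ 0
hamming-self []      = refl
hamming-self (x ∷ u) = trans (hamming-∷ x x u u) (cong₂ _+_ (bitDistance-self x) (hamming-self u))

hamming-triangle : ∀ {n} (u v w : Vertex n) → hamming u v ≤ hamming u w + hamming w v
hamming-triangle []      []      []      = z≤n
hamming-triangle (x ∷ u) (y ∷ v) (z ∷ w) = begin
  hamming (x ∷ u) (y ∷ v)
    ≡⟨ hamming-∷ x y u v ⟩
  bitDistance x y + hamming u v
    ≤⟨ +-mono-≤ (bitDistance-triangle x y z) (hamming-triangle u v w) ⟩
  (bitDistance x z + bitDistance z y) + (hamming u w + hamming w v)
    ≡⟨ interchange (bitDistance x z) (bitDistance z y) (hamming u w) (hamming w v) ⟩
  (bitDistance x z + hamming u w) + (bitDistance z y + hamming w v)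
    ≡⟨ cong₂ _+_ (hamming-∷ x z u w) (hamming-∷ z y w v) ⟨
  hamming (x ∷ u) (z ∷ w) + hamming (z ∷ w) (y ∷ v) ∎
  where open ≤-Reasoning

infixr 6 _⊕_

_⊕_ : ∀ {n} → Vertex n → Vertex n → Vertex n
_⊕_ = zipWith _xor_

⊕-cancelˡ : ∀ {n} (a u : Vertex n) → a ⊕ a ⊕ u ≡ u
⊕-cancelˡ []       []      = refl
⊕-cancelˡ (a ∷ as) (x ∷ u) =
  cong₂ _∷_ (trans (sym (xor-assoc a a x)) (cong (_xor x) (xor-same a))) (⊕-cancelˡ as u)

⊕-self : ∀ {n} (u : Vertex n) → u ⊕ u ≡ 𝟎
⊕-self []      = refl
⊕-self (x ∷ u) = cong₂ _∷_ (xor-same x) (⊕-self u)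

hamming-⊕ˡ : ∀ {n} (a u v : Vertex n) → hamming (a ⊕ u) (a ⊕ v) ≡ hamming u v
hamming-⊕ˡ []       []      []      = refl
hamming-⊕ˡ (a ∷ as) (x ∷ u) (y ∷ v) = begin
  hamming ((a ∷ as) ⊕ (x ∷ u)) ((a ∷ as) ⊕ (y ∷ v))
    ≡⟨ hamming-∷ (a xor x) (a xor y) (as ⊕ u) (as ⊕ v) ⟩
  bitDistance (a xor x) (a xor y) + hamming (as ⊕ u) (as ⊕ v)
    ≡⟨ cong₂ _+_ (bitDistance-xorˡ a x y) (hamming-⊕ˡ as u v) ⟩
  bitDistance x y + hamming u v
    ≡⟨ hamming-∷ x y u v ⟨
  hamming (x ∷ u) (y ∷ v) ∎
  where open ≡-Reasoning

𝟏 : ∀ {n} → Vertex n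
𝟏 = replicate _ true

hamming-complement : ∀ {n} (u v : Vertex n) → hamming u (𝟏 ⊕ v) + hamming u v ≡ n
hamming-complement []          []          = refl
hamming-complement (true  ∷ u) (true  ∷ v) = cong suc (hamming-complement u v)
hamming-complement (false ∷ u) (false ∷ v) = cong suc (hamming-complement u v)
hamming-complement (true  ∷ u) (false ∷ v) = trans (+-suc _ _) (cong suc (hamming-complement u v))
hamming-complement (false ∷ u) (true  ∷ v) = trans (+-suc _ _) (cong suc (hamming-complement u v))

allBut : ∀ {n} → Fin n → Vertex n
allBut zero    = false ∷ 𝟏
allBut (suc i) = true ∷ allBut i

lookup-allBut-⊕ : ∀ {n} (i : Fin n) (v : Vertex n) → lookup (allBut i ⊕ v) i ≡ lookup v i
lookup-allBut-⊕ zero    (x ∷ v) = refl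
lookup-allBut-⊕ (suc i) (x ∷ v) = lookup-allBut-⊕ i v

hamming-allBut-⊕ : ∀ {n} (i : Fin n) (u v : Vertex n) → lookup u i ≡ false → lookup v i ≡ true →
  hamming u (allBut i ⊕ v) + hamming u v ≡ suc n
hamming-allBut-⊕ zero (false ∷ u) (true ∷ v) _ _ =
  cong suc (trans (+-suc _ _) (cong suc (hamming-complement u v)))
hamming-allBut-⊕ (suc i) (true  ∷ u) (true  ∷ v) uᵢ vᵢ = cong suc (hamming-allBut-⊕ i u v uᵢ vᵢ)
hamming-allBut-⊕ (suc i) (false ∷ u) (false ∷ v) uᵢ vᵢ = cong suc (hamming-allBut-⊕ i u v uᵢ vᵢ)
hamming-allBut-⊕ (suc i) (true  ∷ u) (false ∷ v) uᵢ vᵢ =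
  trans (+-suc _ _) (cong suc (hamming-allBut-⊕ i u v uᵢ vᵢ))
hamming-allBut-⊕ (suc i) (false ∷ u) (true  ∷ v) uᵢ vᵢ =
  trans (+-suc _ _) (cong suc (hamming-allBut-⊕ i u v uᵢ vᵢ))

allBut-⊕-𝟏 : ∀ {n} (i : Fin (suc (suc n))) → allBut i ⊕ 𝟏 ≢ 𝟏
allBut-⊕-𝟏 zero    ()
allBut-⊕-𝟏 (suc i) ()

-- FQ n u v unfolds to FQDistance n (hamming u v).
FQDistance : ℕ → ℕ → Set
FQDistance n h = h ≡ 1 ⊎ h ≡ n

FQDistance-complement : ∀ {n} a b → a + b ≡ suc n → FQDistance n b → FQDistance n a
FQDistance-complement     a _ a+1≡1+n (inj₁ refl) = inj₂ (suc-injective (trans (+-comm 1 a) a+1≡1+n))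
FQDistance-complement {n} a _ a+n≡1+n (inj₂ refl) = inj₁ (+-cancelʳ-≡ n a 1 a+n≡1+n)

data Walk {V : Set} (G : Graph V) : ℕ → V → V → Set where
  []  : ∀ {u} → Walk G 0 u u
  _∷_ : ∀ {k u w v} → G u w → Walk G k w v → Walk G (suc k) u v

walk-map : ∀ {V W : Set} {G : Graph V} {H : Graph W} (f : V → W) →
  (∀ u v → G u v → H (f u) (f v)) →
  ∀ {k u v} → Walk G k u v → Walk H k (f u) (f v)
walk-map f f-adj []                     = []
walk-map f f-adj (_∷_ {u = u} {w} e es) = f-adj u w e ∷ walk-map f f-adj es

hamming-≤-walkLength : ∀ {n k} {u v : Vertex n} → Walk (Q n) k u v → hamming u v ≤ k
hamming-≤-walkLength {u = u} [] = ≤-reflexive (hamming-self u)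
hamming-≤-walkLength {k = suc k} {u} {v} (_∷_ {w = w} uw walk) = begin
  hamming u v               ≤⟨ hamming-triangle u v w ⟩
  hamming u w + hamming w v ≡⟨ cong (_+ hamming w v) uw ⟩
  suc (hamming w v)         ≤⟨ s≤s (hamming-≤-walkLength walk) ⟩
  suc k                     ∎
  where open ≤-Reasoning

Q-∷ : ∀ {n} x (u v : Vertex n) → Q n u v → Q (suc n) (x ∷ u) (x ∷ v)
Q-∷ true  u v uv = uv
Q-∷ false u v uv = uv

Q-not∷ : ∀ {n} x (u : Vertex n) → Q (suc n) (x ∷ u) (not x ∷ u)
Q-not∷ true  u = cong suc (hamming-self u)
Q-not∷ false u = cong suc (hamming-self u)

hammingWalk : ∀ {n} (u v : Vertex n) → Walk (Q n) (hamming u v) u v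
hammingWalk []          []          = []
hammingWalk (true  ∷ u) (true  ∷ v) = walk-map (true ∷_) (Q-∷ true) (hammingWalk u v)
hammingWalk (false ∷ u) (false ∷ v) = walk-map (false ∷_) (Q-∷ false) (hammingWalk u v)
hammingWalk (true  ∷ u) (false ∷ v) = Q-not∷ true u ∷ walk-map (false ∷_) (Q-∷ false) (hammingWalk u v)
hammingWalk (false ∷ u) (true  ∷ v) = Q-not∷ false u ∷ walk-map (true ∷_) (Q-∷ true) (hammingWalk u v)

Q-homomorphism-nonexpanding : ∀ {m n} (f : Vertex m → Vertex n) →
  (∀ u v → Q m u v → Q n (f u) (f v)) →
  ∀ u v → hamming (f u) (f v) ≤ hamming u v
Q-homomorphism-nonexpanding f f-adj u v = hamming-≤-walkLength (walk-map f f-adj (hammingWalk u v))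

module _ {V : Set} {G : Graph V} where
  open Automorphism

  to-adj : (φ : Automorphism G) → ∀ u v → G u v → G (to φ u) (to φ v)
  to-adj φ u v = proj₁ (adj-⇔ φ u v)

  to-injective : (φ : Automorphism G) → ∀ {u v} → to φ u ≡ to φ v → u ≡ v
  to-injective φ {u} {v} eq = trans (sym (from-to φ u)) (trans (cong (from φ) eq) (from-to φ v))

  inverse : Automorphism G → Automorphism G
  inverse φ = record
    { to      = from φ
    ; from    = to φ
    ; to-from = from-to φ
    ; from-to = to-from φ
    ; adj-⇔   = λ u v → from-adj u v
                      , subst₂ G (to-from φ u) (to-from φ v) ∘ to-adj φ (from φ u) (from φ v)
    }
    where
    from-adj : ∀ u v → G u v → G (from φ u) (from φ v)
    from-adj u v e =
      proj₂ (adj-⇔ φ (from φ u) (from φ v)) (subst₂ G (sym (to-from φ u)) (sym (to-from φ v)) e)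

  infixr 9 _∘ᴬ_

  _∘ᴬ_ : Automorphism G → Automorphism G → Automorphism G
  φ ∘ᴬ ψ = record
    { to      = to φ ∘ to ψ
    ; from    = from ψ ∘ from φ
    ; to-from = λ v → trans (cong (to φ) (to-from ψ (from φ v))) (to-from φ v)
    ; from-to = λ v → trans (cong (from ψ) (from-to φ (to ψ v))) (from-to ψ v)
    ; adj-⇔   = λ u v → to-adj φ (to ψ u) (to ψ v) ∘ to-adj ψ u v
                      , proj₂ (adj-⇔ ψ u v) ∘ proj₂ (adj-⇔ φ (to ψ u) (to ψ v))
    }

  involution⇒automorphism : (f : V → V) → (∀ v → f (f v) ≡ v) →
    (∀ u v → G u v → G (f u) (f v)) → Automorphism G
  involution⇒automorphism f f-involutive f-adj = record
    { to      = f
    ; from    = f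
    ; to-from = f-involutive
    ; from-to = f-involutive
    ; adj-⇔   = λ u v → f-adj u v
                      , subst₂ G (f-involutive u) (f-involutive v) ∘ f-adj (f u) (f v)
    }

  -- If φ fixes α(S) pointwise, then α⁻¹ ∘ φ ∘ α fixes S pointwise, hence is the identity.
  determining-image : (α : Automorphism G) {S : List V} →
    IsDetermining G S → IsDetermining G (map (to α) S)
  determining-image α {S} det φ fixes v = begin
    to φ v                        ≡⟨ cong (to φ) (sym (to-from α v)) ⟩
    to φ (to α w)                 ≡⟨ sym (to-from α _) ⟩
    to α (from α (to φ (to α w))) ≡⟨ cong (to α) (det (inverse α ∘ᴬ φ ∘ᴬ α) conjugate-fixes w) ⟩
    to α w                        ≡⟨ to-from α v ⟩
    v                             ∎
    where
    open ≡-Reasoning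
    w = from α v
    conjugate-fixes : ∀ s → s ∈ S → from α (to φ (to α s)) ≡ s
    conjugate-fixes s s∈S = trans (cong (from α) (fixes (to α s) (∈-map⁺ (to α) s∈S))) (from-to α s)

open Automorphism

Q-automorphism-isometry : ∀ {n} (φ : Automorphism (Q n)) (u v : Vertex n) →
  hamming (to φ u) (to φ v) ≡ hamming u v
Q-automorphism-isometry φ u v = ≤-antisym
  (Q-homomorphism-nonexpanding (to φ) (to-adj φ) u v)
  (begin
    hamming u v
      ≡⟨ cong₂ hamming (from-to φ u) (from-to φ v) ⟨
    hamming (from φ (to φ u)) (from φ (to φ v))
      ≤⟨ Q-homomorphism-nonexpanding (from φ) (to-adj (inverse φ)) (to φ u) (to φ v) ⟩
    hamming (to φ u) (to φ v) ∎)
  where open ≤-Reasoning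

Q⇒FQ-automorphism : ∀ {n} → Automorphism (Q n) → Automorphism (FQ n)
Q⇒FQ-automorphism φ = record
  { to      = to φ
  ; from    = from φ
  ; to-from = to-from φ
  ; from-to = from-to φ
  ; adj-⇔   = λ u v → subst (FQDistance _) (sym (Q-automorphism-isometry φ u v))
                    , subst (FQDistance _) (Q-automorphism-isometry φ u v)
  }

FQ-determining⇒Q-determining : ∀ {n} {S : List (Vertex n)} →
  IsDetermining (FQ n) S → IsDetermining (Q n) S
FQ-determining⇒Q-determining det φ = det (Q⇒FQ-automorphism φ)

translation : ∀ {n} → Vertex n → Automorphism (FQ n)
translation a = involution⇒automorphism (a ⊕_) (⊕-cancelˡ a)
  (λ u v → subst (FQDistance _) (sym (hamming-⊕ˡ a u v)))

complementHalf : ∀ {n} → Fin n → Vertex n → Vertex n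
complementHalf i v = if lookup v i then allBut i ⊕ v else v

complementHalf-fixes : ∀ {n} (i : Fin n) {v : Vertex n} → lookup v i ≡ false → complementHalf i v ≡ v
complementHalf-fixes i vᵢ rewrite vᵢ = refl

complementHalf-𝟏 : ∀ {n} (i : Fin n) → complementHalf i 𝟏 ≡ allBut i ⊕ 𝟏
complementHalf-𝟏 i rewrite lookup-replicate i true = refl

complementHalf-involutive : ∀ {n} (i : Fin n) (v : Vertex n) → complementHalf i (complementHalf i v) ≡ v
complementHalf-involutive i v with lookup v i in vᵢ
... | false rewrite vᵢ = refl
... | true  rewrite lookup-allBut-⊕ i v | vᵢ = ⊕-cancelˡ (allBut i) v

complementHalf-adj : ∀ {n} (i : Fin n) (u v : Vertex n) →
  FQ n u v → FQ n (complementHalf i u) (complementHalf i v)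
complementHalf-adj i u v uv with lookup u i in uᵢ | lookup v i in vᵢ
... | false | false = uv
... | true  | true  = subst (FQDistance _) (sym (hamming-⊕ˡ (allBut i) u v)) uv
... | false | true  = FQDistance-complement _ _ (hamming-allBut-⊕ i u v uᵢ vᵢ) uv
... | true  | false = FQDistance-complement _ _
  (trans (cong₂ _+_ (hamming-sym _ v) (hamming-sym u v)) (hamming-allBut-⊕ i v u vᵢ uᵢ)) uv

complementHalf-automorphism : ∀ {n} → Fin n → Automorphism (FQ n)
complementHalf-automorphism i =
  involution⇒automorphism (complementHalf i) (complementHalf-involutive i) (complementHalf-adj i)

FQ-determining-meets-halves : ∀ {n} {S : List (Vertex (suc (suc n)))} →
  IsDetermining (FQ (suc (suc n))) S →
  (i : Fin (suc (suc n))) → Σ (Vertex (suc (suc n))) λ v → v ∈ S × lookup v i ≡ true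
FQ-determining-meets-halves {S = S} det i with any? (λ v → lookup v i ≟ true) S
... | yes hit  = find hit
... | no  miss = ⊥-elim (allBut-⊕-𝟏 i 𝟏-fixed)
  where
  fixes : ∀ s → s ∈ S → complementHalf i s ≡ s
  fixes s s∈S = complementHalf-fixes i (¬-not (miss ∘ lose s∈S))
  𝟏-fixed : allBut i ⊕ 𝟏 ≡ 𝟏
  𝟏-fixed = trans (sym (complementHalf-𝟏 i)) (det (complementHalf-automorphism i) fixes 𝟏)

lemma5p1 : (n : ℕ) → 4 ≤ n → (S : List (Vertex n)) → Unique S →
    IsDetermining (FQ n) S →
    IsDetermining (Q n) S
    × (Σ (List (Vertex n)) λ T → Unique T × length T ≡ length S
         × IsDetermining (FQ n) T × 𝟎 ∈ T)
    × ((i : Fin n) → Σ (Vertex n) λ v → v ∈ S × lookup v i ≡ true)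
lemma5p1 (suc (suc n)) (s≤s (s≤s _)) S unique det =
    FQ-determining⇒Q-determining det
  , ( map (s ⊕_) S
    , map⁺ (to-injective (translation s)) unique
    , length-map (s ⊕_) S
    , determining-image (translation s) det
    , subst (_∈ map (s ⊕_) S) (⊕-self s) (∈-map⁺ (s ⊕_) s∈S) )
  , meets
  where
  meets : (i : Fin (suc (suc n))) → Σ (Vertex (suc (suc n))) λ v → v ∈ S × lookup v i ≡ true
  meets = FQ-determining-meets-halves det
  s : Vertex (suc (suc n))
  s = proj₁ (meets zero)
  s∈S : s ∈ S
  s∈S = proj₁ (proj₂ (meets zero))
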